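{- The localization number of the incidence graph of any Steiner triple system $\mathrm{STS}(v)$ is at most $\frac{v+1}{2}$.
   Context: A Steiner triple system $\mathrm{STS}(v)$ ($v \ge 7$) is a set $X$ of $v$ points with a collection of $3$-element subsets (blocks) such that every pair of distinct points lies in exactly one block. Its incidence graph is the bipartite graph on points and blocks with $x \sim B$ iff $x \in B$. Localization game on a connected graph $G$ with $k$ cops: the robber chooses a starting vertex, invisible to the cops. Each round the cops choose any $k$ vertices (no adjacency restriction) and each learns its distance to the robber; the cops win if after finitely many rounds they determine the robber's vertex uniquely; otherwise the robber moves to a neighbour or stays. The robber knows the cops' strategy. The localization number $\zeta(G)$ is the least $k$ for which $k$ cops can guarantee capture. -}

module Defs where

open import Data.Nat using (ℕ; zero; suc; _+_)
open import Data.Bool using (Bool; true; false; _∨_; _∧_; if_then_else_)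
open import Data.Fin using (Fin; splitAt)
open import Data.Fin.Properties using (_≟_)
open import Data.List using (List; []; _∷_)
open import Data.Bool.ListAction using (any)
open import Data.List.Base using (allFin)
open import Data.Vec using (Vec; map)
open import Data.Product using (Σ; _×_; _,_; ∃; ∃!)
open import Data.Sum using (_⊎_; inj₁; inj₂)
open import Relation.Nullary using (¬_)
open import Relation.Nullary.Decidable using (⌊_⌋; _⊎-dec_)
open import Relation.Binary.PropositionalEquality using (_≡_; _≢_)

record Graph : Set where
  field
    n   : ℕ
    adj : Fin n → Fin n → Bool
open Graph public

ball : (G : Graph) → ℕ → Fin (n G) → Fin (n G) → Bool
ball G zero    u w = ⌊ u ≟ w ⌋
ball G (suc d) u w = ball G d u w ∨ any (λ z → ball G d u z ∧ adj G z w) (allFin (n G))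

distFrom : (G : Graph) → ℕ → ℕ → Fin (n G) → Fin (n G) → ℕ
distFrom G zero       d u w = d
distFrom G (suc fuel) d u w = if ball G d u w then d else distFrom G fuel (suc d) u w

-- graph distance (for connected graphs the true distance is < n, so fuel n suffices)
dist : (G : Graph) → Fin (n G) → Fin (n G) → ℕ
dist G u w = distFrom G (n G) 0 u w

Connected : Graph → Set
Connected G = ∀ u w → ball G (n G) u w ≡ true

IsRobberWalk : (G : Graph) → (ℕ → Fin (n G)) → Set
IsRobberWalk G r = ∀ t → (r (suc t) ≡ r t) ⊎ (adj G (r t) (r (suc t)) ≡ true)

-- a (deterministic) cop strategy: from the list of observations so far
-- (most recent first) choose the k probed vertices of the next round
CopStrategy : Graph → ℕ → Set
CopStrategy G k = List (Vec ℕ k) → Vec (Fin (n G)) k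

-- observations (most recent first) of rounds 0 .. t-1 against robber walk r
history : (G : Graph) {k : ℕ} → CopStrategy G k → (ℕ → Fin (n G)) → ℕ → List (Vec ℕ k)
history G σ r zero    = []
history G σ r (suc t) =
  let h = history G σ r t in map (λ c → dist G c (r t)) (σ h) ∷ h

Wins : (G : Graph) {k : ℕ} → CopStrategy G k → Set
Wins G σ = ∀ r → IsRobberWalk G r →
  ∃ λ t → ∀ r' → IsRobberWalk G r' →
    history G σ r' (suc t) ≡ history G σ r (suc t) → r' t ≡ r t

CopsWin : Graph → ℕ → Set
CopsWin G k = Σ (CopStrategy G k) (Wins G)

LocNumAtMost : Graph → ℕ → Set
LocNumAtMost G m = ∃ λ k → k Data.Nat.≤ m × CopsWin G k

record STS (v : ℕ) : Set where
  field
    b        : ℕ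
    block    : Fin b → Fin v × Fin v × Fin v
    distinct : ∀ j → let (x , y , z) = block j in x ≢ y × x ≢ z × y ≢ z

  _∈B_ : Fin v → Fin b → Set
  x ∈B j = let (p , q , s) = block j in (x ≡ p) ⊎ (x ≡ q) ⊎ (x ≡ s)

  field
    pairUnique : ∀ x y → x ≢ y → ∃! _≡_ (λ j → x ∈B j × y ∈B j)

  memb : Fin v → Fin b → Bool
  memb x j = let (p , q , s) = block j in ⌊ (x ≟ p) ⊎-dec ((x ≟ q) ⊎-dec (x ≟ s)) ⌋
open STS public

-- incidence graph: vertices Fin (v + b); the first v are points, the rest blocks
incidenceAdj : {v : ℕ} (S : STS v) → Fin (v + b S) → Fin (v + b S) → Bool
incidenceAdj {v} S u w with splitAt v u | splitAt v w
... | inj₁ x | inj₂ j = memb S x j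
... | inj₂ j | inj₁ x = memb S x j
... | _      | _      = false

incidenceGraph : {v : ℕ} → STS v → Graph
incidenceGraph {v} S = record { n = v + b S ; adj = incidenceAdj S }

-- The cops probe the first k = (v + 1) / 2 points, then the last k, then the first k again; the
-- two halves cover all points. Seen from a point x the robber is at distance 0 (on x), 1 (on a
-- block through x), 2 (on another point) or 3 (on a block missing x). Hence a probed point
-- locates a robber standing on it, and two probed points of a block locate a robber on that
-- block, since two points lie on a unique block. Tracing the robber for three rounds, the only
-- remaining case is a step from a block j containing at most one point y of the earlier probe
-- set onto y, now unprobed. Then any consistent robber stands on an unprobed, hence earlier
-- probed, point y′ of its previous block; the earlier probe of y′ then puts y′ on j, so y′ = y.

module Submission where

open import Defs
open import Data.Nat using (ℕ; _+_; _≤_)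
open import Data.Nat.DivMod using (_/_)

open import Data.Nat using (zero; suc; _<_; _∸_; _*_; s≤s; z≤n; _≤′_; ≤′-refl; ≤′-step; _<?_; >-nonZero⁻¹)
open import Data.Nat.Properties
  using (≤-refl; ≤-trans; <-trans; ≤-pred; ≤⇒≯; ≮⇒≥; ≤⇒≤′; m≤n⇒m<n∨m≡n; m<1+n⇒m≤n; n<1+n; n≤1+n; m≤m+n;
         +-comm; +-suc; +-identityʳ; *-comm; +-monoˡ-≤; ∸-monoʳ-<; m≤n+o⇒m∸n≤o; module ≤-Reasoning)
open import Data.Nat.DivMod using (_%_; m≡m%n+[m/n]*n; m%n<n; m/n<m)
open import Data.Bool using (true; false)
open import Data.Bool.Properties using (T-≡; T-∨; T-∧)
open import Data.Fin using (Fin; toℕ; fromℕ<; inject≤; opposite; _≟_; _↑ˡ_; _↑ʳ_; splitAt)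
open import Data.Fin.Properties
  using (nonZeroIndex; toℕ<n; toℕ-injective; toℕ-fromℕ<; toℕ-inject≤; opposite-prop; opposite-involutive;
         splitAt-↑ˡ; splitAt-↑ʳ; splitAt⁻¹-↑ˡ; splitAt⁻¹-↑ʳ; ↑ˡ-injective; ↑ʳ-injective)
open import Data.List using (allFin; []; _∷_)
open import Data.List.Properties using (∷-injectiveˡ; ∷-injectiveʳ)
open import Data.List.Relation.Unary.Any as Any using (satisfied)
open import Data.List.Relation.Unary.Any.Properties using (any⁺; any⁻)
open import Data.List.Membership.Propositional.Properties using (∈-allFin)
open import Data.Vec using (Vec; map; lookup; tabulate)
open import Data.Vec.Properties using (lookup-map; lookup∘tabulate)
open import Data.Product using (∃; _×_; _,_; proj₁; proj₂)
open import Data.Sum using (_⊎_; inj₁; inj₂; [_,_]′; map₂; swap)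
open import Function using (_∘_; id)
open import Function.Bundles using (Equivalence)
open import Relation.Nullary using (¬_; Dec; yes; no; contradiction)
open import Relation.Nullary.Decidable using (toWitness; fromWitness; _⊎-dec_)
open import Relation.Unary using (Decidable)
open import Relation.Binary.PropositionalEquality
  using (_≡_; _≢_; refl; sym; trans; cong; subst; module ≡-Reasoning)

open Equivalence using (to; from)

module _ (G : Graph) where

  Move : Fin (n G) → Fin (n G) → Set
  Move u w = w ≡ u ⊎ adj G u w ≡ true

  ball-zero⁻ : ∀ {u w} → ball G 0 u w ≡ true → w ≡ u
  ball-zero⁻ h = sym (toWitness (from T-≡ h))

  ball-zero-refl : ∀ u → ball G 0 u u ≡ true
  ball-zero-refl u = to T-≡ (fromWitness refl)

  ball-suc⁺ˡ : ∀ {d u w} → ball G d u w ≡ true → ball G (suc d) u w ≡ true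
  ball-suc⁺ˡ h rewrite h = refl

  ball-suc⁺ʳ : ∀ {d u z w} → ball G d u z ≡ true → adj G z w ≡ true → ball G (suc d) u w ≡ true
  ball-suc⁺ʳ {z = z} uz zw =
    to T-≡ (from T-∨ (inj₂ (any⁺ _ (Any.map
      (λ { refl → from T-∧ (from T-≡ uz , from T-≡ zw) }) (∈-allFin z)))))

  ball-suc⁻ : ∀ {d u w} → ball G (suc d) u w ≡ true →
              ball G d u w ≡ true ⊎ ∃ λ z → ball G d u z ≡ true × adj G z w ≡ true
  ball-suc⁻ h with to T-∨ (from T-≡ h)
  ... | inj₁ uw = inj₁ (to T-≡ uw)
  ... | inj₂ any-z with satisfied (any⁻ _ (allFin (n G)) any-z)
  ...   | z , uzw with to T-∧ uzw
  ...     | uz , zw = inj₂ (z , to T-≡ uz , to T-≡ zw)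

  ball-one⁻ : ∀ {u w} → ball G 1 u w ≡ true → Move u w
  ball-one⁻ {u} {w} h with ball-suc⁻ {0} {u} {w} h
  ... | inj₁ uw = inj₁ (ball-zero⁻ uw)
  ... | inj₂ (z , uz , zw) with ball-zero⁻ uz
  ...   | refl = inj₂ zw

  ball-mono : ∀ {d e u w} → d ≤ e → ball G d u w ≡ true → ball G e u w ≡ true
  ball-mono d≤e = mono′ (≤⇒≤′ d≤e)
    where
    mono′ : ∀ {d e u w} → d ≤′ e → ball G d u w ≡ true → ball G e u w ≡ true
    mono′ ≤′-refl h = h
    mono′ {u = u} {w} (≤′-step {n = e} d≤′e) h = ball-suc⁺ˡ {e} {u} {w} (mono′ d≤′e h)

  distFrom-≡ : ∀ {m u w} fuel d → d ≤ m → m < d + fuel →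
               ball G m u w ≡ true → (∀ {e} → e < m → ball G e u w ≢ true) →
               distFrom G fuel d u w ≡ m
  distFrom-≡ {m} zero d d≤m m<d _ _ = contradiction (subst (m <_) (+-identityʳ d) m<d) (≤⇒≯ d≤m)
  distFrom-≡ {m} {u} {w} (suc fuel) d d≤m m<d+fuel reach below with m≤n⇒m<n∨m≡n d≤m
  ... | inj₂ refl rewrite reach = refl
  ... | inj₁ d<m with ball G d u w in eq
  ...   | true = contradiction eq (below d<m)
  ...   | false = distFrom-≡ fuel (suc d) d<m (subst (m <_) (+-suc d fuel) m<d+fuel) reach below

  dist-refl : ∀ u → dist G u u ≡ 0
  dist-refl u = distFrom-≡ (n G) 0 z≤n (>-nonZero⁻¹ (n G) ⦃ nonZeroIndex u ⦄) (ball-zero-refl u) (λ ())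

  dist-≡ : ∀ {u w} m → suc m < n G → ball G (suc m) u w ≡ true → ball G m u w ≢ true → dist G u w ≡ suc m
  dist-≡ m m<n reach ¬m = distFrom-≡ (n G) 0 z≤n m<n reach
    (λ e<1+m ball-e → ¬m (ball-mono (m<1+n⇒m≤n e<1+m) ball-e))

module _ {G : Graph} {k : ℕ} (σ : CopStrategy G k) {r r′ : ℕ → Fin (n G)} where

  latest-observation-agrees : ∀ {t} → history G σ r′ (suc t) ≡ history G σ r (suc t) →
    map (λ c → dist G c (r′ t)) (σ (history G σ r t)) ≡ map (λ c → dist G c (r t)) (σ (history G σ r t))
  latest-observation-agrees {t} eq =
    subst (λ h → map (λ c → dist G c (r′ t)) (σ h) ≡ _) (∷-injectiveʳ eq) (∷-injectiveˡ eq)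

  observations-agree : ∀ t → history G σ r′ (suc t) ≡ history G σ r (suc t) → ∀ s → s ≤ t →
    map (λ c → dist G c (r′ s)) (σ (history G σ r s)) ≡ map (λ c → dist G c (r s)) (σ (history G σ r s))
  observations-agree zero    eq .zero z≤n = latest-observation-agrees eq
  observations-agree (suc t) eq s s≤1+t with m≤n⇒m<n∨m≡n s≤1+t
  ... | inj₁ s<1+t = observations-agree t (∷-injectiveʳ eq) s (m<1+n⇒m≤n s<1+t)
  ... | inj₂ refl = latest-observation-agrees eq

module Incidence {v : ℕ} (S : STS v) (3<v : 3 < v) where
  open STS S using () renaming (_∈B_ to _∈_)

  G : Graph
  G = incidenceGraph S

  pt : Fin v → Fin (v + b S)
  pt x = x ↑ˡ b S

  bl : Fin (b S) → Fin (v + b S)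
  bl j = v ↑ʳ j

  data Vertex : Fin (v + b S) → Set where
    at-point : ∀ x → Vertex (pt x)
    at-block : ∀ j → Vertex (bl j)

  vertex : ∀ w → Vertex w
  vertex w with splitAt v w in eq
  ... | inj₁ x = subst Vertex (splitAt⁻¹-↑ˡ eq) (at-point x)
  ... | inj₂ j = subst Vertex (splitAt⁻¹-↑ʳ eq) (at-block j)

  pt-injective : ∀ {x y} → pt x ≡ pt y → x ≡ y
  pt-injective = ↑ˡ-injective (b S) _ _

  bl-injective : ∀ {i j} → bl i ≡ bl j → i ≡ j
  bl-injective = ↑ʳ-injective v _ _

  pt≢bl : ∀ {x j} → pt x ≢ bl j
  pt≢bl {x} {j} e with trans (sym (splitAt-↑ˡ v x (b S))) (trans (cong (splitAt v) e) (splitAt-↑ʳ v (b S) j))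
  ... | ()

  _∈?_ : ∀ x j → Dec (x ∈ j)
  x ∈? j = (x ≟ proj₁ (block S j)) ⊎-dec ((x ≟ proj₁ (proj₂ (block S j))) ⊎-dec (x ≟ proj₂ (proj₂ (block S j))))

  memb⁻ : ∀ {x j} → memb S x j ≡ true → x ∈ j
  memb⁻ h = toWitness (from T-≡ h)

  memb⁺ : ∀ {x j} → x ∈ j → memb S x j ≡ true
  memb⁺ x∈j = to T-≡ (fromWitness x∈j)

  adj-pt-pt : ∀ x y → adj G (pt x) (pt y) ≡ false
  adj-pt-pt x y rewrite splitAt-↑ˡ v x (b S) | splitAt-↑ˡ v y (b S) = refl

  adj-bl-bl : ∀ i j → adj G (bl i) (bl j) ≡ false
  adj-bl-bl i j rewrite splitAt-↑ʳ v (b S) i | splitAt-↑ʳ v (b S) j = refl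

  adj-pt-bl : ∀ x j → adj G (pt x) (bl j) ≡ memb S x j
  adj-pt-bl x j rewrite splitAt-↑ˡ v x (b S) | splitAt-↑ʳ v (b S) j = refl

  adj-bl-pt : ∀ j x → adj G (bl j) (pt x) ≡ memb S x j
  adj-bl-pt j x rewrite splitAt-↑ˡ v x (b S) | splitAt-↑ʳ v (b S) j = refl

  move-from-point : ∀ {x w} → Move G (pt x) w → w ≡ pt x ⊎ ∃ λ j → w ≡ bl j × x ∈ j
  move-from-point (inj₁ e) = inj₁ e
  move-from-point {x} {w} (inj₂ a) with vertex w
  ... | at-point y = contradiction (trans (sym (adj-pt-pt x y)) a) λ ()
  ... | at-block j = inj₂ (j , refl , memb⁻ (trans (sym (adj-pt-bl x j)) a))

  move-from-block : ∀ {j w} → Move G (bl j) w → w ≡ bl j ⊎ ∃ λ y → w ≡ pt y × y ∈ j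
  move-from-block (inj₁ e) = inj₁ e
  move-from-block {j} {w} (inj₂ a) with vertex w
  ... | at-point y = inj₂ (y , refl , memb⁻ (trans (sym (adj-bl-pt j y)) a))
  ... | at-block i = contradiction (trans (sym (adj-bl-bl j i)) a) λ ()

  walk-from-point : ∀ {r t x} → IsRobberWalk G r → r t ≡ pt x →
                    r (suc t) ≡ pt x ⊎ ∃ λ j → r (suc t) ≡ bl j × x ∈ j
  walk-from-point {r} walk e = move-from-point (subst (λ u → Move G u (r _)) e (walk _))

  walk-from-block : ∀ {r t j} → IsRobberWalk G r → r t ≡ bl j →
                    r (suc t) ≡ bl j ⊎ ∃ λ y → r (suc t) ≡ pt y × y ∈ j
  walk-from-block {r} walk e = move-from-block (subst (λ u → Move G u (r _)) e (walk _))

  move-pt-bl⁻ : ∀ {x j} → Move G (pt x) (bl j) → x ∈ j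
  move-pt-bl⁻ m with move-from-point m
  ... | inj₁ e = contradiction (sym e) pt≢bl
  ... | inj₂ (i , e , x∈i) = subst (_ ∈_) (sym (bl-injective e)) x∈i

  move-bl-pt⁻ : ∀ {j y} → Move G (bl j) (pt y) → y ∈ j
  move-bl-pt⁻ m with move-from-block m
  ... | inj₁ e = contradiction e pt≢bl
  ... | inj₂ (y′ , e , y′∈j) = subst (_∈ _) (sym (pt-injective e)) y′∈j

  ball-pt-bl : ∀ {x j} → x ∈ j → ball G 1 (pt x) (bl j) ≡ true
  ball-pt-bl {x} {j} x∈j = ball-suc⁺ʳ G {0} (ball-zero-refl G (pt x)) (trans (adj-pt-bl x j) (memb⁺ x∈j))

  ball-pt-pt : ∀ {x y} → x ≢ y → ball G 2 (pt x) (pt y) ≡ true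
  ball-pt-pt {x} {y} x≢y with pairUnique S x y x≢y
  ... | j , (x∈j , y∈j) , _ = ball-suc⁺ʳ G {1} (ball-pt-bl x∈j) (trans (adj-bl-pt j y) (memb⁺ y∈j))

  ball-pt-far : ∀ {x j} → ¬ x ∈ j → ball G 3 (pt x) (bl j) ≡ true
  ball-pt-far {x} {j} x∉j =
    ball-suc⁺ʳ G {2} (ball-pt-pt (λ x≡p → x∉j (inj₁ x≡p))) (trans (adj-pt-bl p j) (memb⁺ (inj₁ refl)))
    where
    p : Fin v
    p = proj₁ (block S j)

  ball-pt-bl⁻ : ∀ {x j} → ball G 2 (pt x) (bl j) ≡ true → x ∈ j
  ball-pt-bl⁻ {x} {j} h with ball-suc⁻ G {1} h
  ... | inj₁ near = move-pt-bl⁻ (ball-one⁻ G near)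
  ... | inj₂ (z , xz , zj) with move-from-point (ball-one⁻ G xz)
  ...   | inj₁ refl = memb⁻ (trans (sym (adj-pt-bl x j)) zj)
  ...   | inj₂ (i , refl , _) = contradiction (trans (sym (adj-bl-bl i j)) zj) λ ()

  3<n : 3 < n G
  3<n = ≤-trans 3<v (m≤m+n v (b S))

  dist-pt-self : ∀ {x} → dist G (pt x) (pt x) ≡ 0
  dist-pt-self {x} = dist-refl G (pt x)

  dist-pt-bl-∈ : ∀ {x j} → x ∈ j → dist G (pt x) (bl j) ≡ 1
  dist-pt-bl-∈ x∈j = dist-≡ G 0 (<-trans (s≤s (s≤s z≤n)) 3<n) (ball-pt-bl x∈j) (λ h → pt≢bl (sym (ball-zero⁻ G h)))

  dist-pt-pt : ∀ {x y} → x ≢ y → dist G (pt x) (pt y) ≡ 2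
  dist-pt-pt x≢y = dist-≡ G 1 (<-trans (s≤s (s≤s (s≤s z≤n))) 3<n) (ball-pt-pt x≢y) ¬ball₁
    where
    ¬ball₁ : ball G 1 _ _ ≢ true
    ¬ball₁ h with move-from-point (ball-one⁻ G h)
    ... | inj₁ e = x≢y (sym (pt-injective e))
    ... | inj₂ (_ , e , _) = pt≢bl e

  dist-pt-bl-∉ : ∀ {x j} → ¬ x ∈ j → dist G (pt x) (bl j) ≡ 3
  dist-pt-bl-∉ x∉j = dist-≡ G 2 3<n (ball-pt-far x∉j) (λ h → x∉j (ball-pt-bl⁻ h))

  data PointDistance (x : Fin v) : Fin (v + b S) → ℕ → Set where
    self     : PointDistance x (pt x) 0
    incident : ∀ {j} → x ∈ j → PointDistance x (bl j) 1
    other    : ∀ {y} → x ≢ y → PointDistance x (pt y) 2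
    far      : ∀ {j} → ¬ x ∈ j → PointDistance x (bl j) 3

  point-distance : ∀ x w → PointDistance x w (dist G (pt x) w)
  point-distance x w with vertex w
  ... | at-point y with x ≟ y
  ...   | yes refl = subst (PointDistance x (pt x)) (sym dist-pt-self) self
  ...   | no x≢y = subst (PointDistance x (pt y)) (sym (dist-pt-pt x≢y)) (other x≢y)
  point-distance x w | at-block j with x ∈? j
  ...   | yes x∈j = subst (PointDistance x (bl j)) (sym (dist-pt-bl-∈ x∈j)) (incident x∈j)
  ...   | no x∉j = subst (PointDistance x (bl j)) (sym (dist-pt-bl-∉ x∉j)) (far x∉j)

  dist-pt≡0 : ∀ {x w} → dist G (pt x) w ≡ 0 → w ≡ pt x
  dist-pt≡0 {x} {w} = invert (point-distance x w)
    where
    invert : ∀ {w d} → PointDistance x w d → d ≡ 0 → w ≡ pt x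
    invert self         _  = refl
    invert (incident _) ()
    invert (other _)    ()
    invert (far _)      ()

  dist-pt≡1 : ∀ {x w} → dist G (pt x) w ≡ 1 → ∃ λ j → w ≡ bl j × x ∈ j
  dist-pt≡1 {x} {w} = invert (point-distance x w)
    where
    invert : ∀ {w d} → PointDistance x w d → d ≡ 1 → ∃ λ j → w ≡ bl j × x ∈ j
    invert self             ()
    invert (incident x∈j)   _  = _ , refl , x∈j
    invert (other _)        ()
    invert (far _)          ()

  dist-pt≡2 : ∀ {x w} → dist G (pt x) w ≡ 2 → ∃ λ y → w ≡ pt y
  dist-pt≡2 {x} {w} = invert (point-distance x w)
    where
    invert : ∀ {w d} → PointDistance x w d → d ≡ 2 → ∃ λ y → w ≡ pt y
    invert self         ()
    invert (incident _) ()
    invert (other _)    _  = _ , refl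
    invert (far _)      ()

  dist-pt-bl≡1 : ∀ {x j} → dist G (pt x) (bl j) ≡ 1 → x ∈ j
  dist-pt-bl≡1 h with dist-pt≡1 h
  ... | i , e , x∈i = subst (_ ∈_) (sym (bl-injective e)) x∈i

  block-unique : ∀ {x y i j} → x ≢ y → x ∈ i → y ∈ i → x ∈ j → y ∈ j → i ≡ j
  block-unique {x} {y} x≢y x∈i y∈i x∈j y∈j with pairUnique S x y x≢y
  ... | _ , _ , unique = trans (sym (unique (x∈i , y∈i))) (unique (x∈j , y∈j))

  TwoIn : (Fin v → Set) → Fin (b S) → Set
  TwoIn Q j = ∃ λ x → ∃ λ y → x ≢ y × x ∈ j × y ∈ j × Q x × Q y

  AtMostOneIn : (Fin v → Set) → Fin (b S) → Set
  AtMostOneIn Q j = ∀ {x y} → x ∈ j → y ∈ j → Q x → Q y → x ≡ y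

  two-outside : ∀ {Q Q′ : Fin v → Set} {j a c d} → (∀ {x} → ¬ Q x → Q′ x) →
                a ≢ c → a ∈ j → c ∈ j → ¬ Q a → ¬ Q c → (∀ {x} → x ∈ j → x ≡ a ⊎ x ≡ c ⊎ x ≡ d) →
                AtMostOneIn Q j × TwoIn Q′ j
  two-outside {Q} {j = j} {a} {c} {d} cover a≢c a∈j c∈j a∉Q c∉Q members =
    (λ x∈j y∈j x∈Q y∈Q → trans (is-d x∈j x∈Q) (sym (is-d y∈j y∈Q))) ,
    (a , c , a≢c , a∈j , c∈j , cover a∉Q , cover c∉Q)
    where
    is-d : ∀ {x} → x ∈ j → Q x → x ≡ d
    is-d x∈j x∈Q with members x∈j
    ... | inj₁ refl = contradiction x∈Q a∉Q
    ... | inj₂ (inj₁ refl) = contradiction x∈Q c∉Q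
    ... | inj₂ (inj₂ x≡d) = x≡d

  twoIn⊎atMostOneIn : ∀ {Q Q′ : Fin v → Set} → Decidable Q → (∀ {x} → ¬ Q x → Q′ x) → ∀ j →
                      TwoIn Q j ⊎ (AtMostOneIn Q j × TwoIn Q′ j)
  twoIn⊎atMostOneIn {Q} {Q′} Q? cover j = sort (distinct S j) (Q? p) (Q? q) (Q? r)
    where
    p q r : Fin v
    p = proj₁ (block S j)
    q = proj₁ (proj₂ (block S j))
    r = proj₂ (proj₂ (block S j))
    p∈j : p ∈ j
    p∈j = inj₁ refl
    q∈j : q ∈ j
    q∈j = inj₂ (inj₁ refl)
    r∈j : r ∈ j
    r∈j = inj₂ (inj₂ refl)
    sort : p ≢ q × p ≢ r × q ≢ r → Dec (Q p) → Dec (Q q) → Dec (Q r) →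
           TwoIn Q j ⊎ (AtMostOneIn Q j × TwoIn Q′ j)
    sort (p≢q , _ , _) (yes p∈Q) (yes q∈Q) _ = inj₁ (p , q , p≢q , p∈j , q∈j , p∈Q , q∈Q)
    sort (_ , p≢r , _) (yes p∈Q) (no _) (yes r∈Q) = inj₁ (p , r , p≢r , p∈j , r∈j , p∈Q , r∈Q)
    sort (_ , _ , q≢r) (no _) (yes q∈Q) (yes r∈Q) = inj₁ (q , r , q≢r , q∈j , r∈j , q∈Q , r∈Q)
    sort (_ , _ , q≢r) (yes _) (no q∉Q) (no r∉Q) =
      inj₂ (two-outside cover q≢r q∈j r∈j q∉Q r∉Q [ inj₂ ∘ inj₂ , map₂ inj₁ ]′)
    sort (_ , p≢r , _) (no p∉Q) (yes _) (no r∉Q) =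
      inj₂ (two-outside cover p≢r p∈j r∈j p∉Q r∉Q (map₂ swap))
    sort (p≢q , _ , _) (no p∉Q) (no q∉Q) _ =
      inj₂ (two-outside cover p≢q p∈j q∈j p∉Q q∉Q id)

  Agree : (Fin v → Set) → Fin (v + b S) → Fin (v + b S) → Set
  Agree Q w w′ = ∀ {x} → Q x → dist G (pt x) w′ ≡ dist G (pt x) w

  located-point : ∀ {Q : Fin v → Set} {x w w′} → Q x → w ≡ pt x → Agree Q w w′ → w′ ≡ w
  located-point x∈Q refl agree = dist-pt≡0 (trans (agree x∈Q) dist-pt-self)

  located-block : ∀ {Q j w w′} → TwoIn Q j → w ≡ bl j → Agree Q w w′ → w′ ≡ w
  located-block (x , y , x≢y , x∈j , y∈j , x∈Q , y∈Q) refl agree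
    with dist-pt≡1 (trans (agree x∈Q) (dist-pt-bl-∈ x∈j))
  ... | i , refl , x∈i =
    cong bl (block-unique x≢y x∈i (dist-pt-bl≡1 (trans (agree y∈Q) (dist-pt-bl-∈ y∈j))) x∈j y∈j)

  unprobed-point : ∀ {Q : Fin v → Set} {q y w w′} → Q q → ¬ Q y → w ≡ pt y → Agree Q w w′ →
             ∃ λ y′ → w′ ≡ pt y′ × ¬ Q y′
  unprobed-point {Q} q∈Q y∉Q refl agree
    with dist-pt≡2 (trans (agree q∈Q) (dist-pt-pt λ q≡y → y∉Q (subst Q q≡y q∈Q)))
  ... | y′ , refl = y′ , refl , λ y′∈Q →
    y∉Q (subst Q (sym (pt-injective (dist-pt≡0 (trans (sym (agree y′∈Q)) dist-pt-self)))) y′∈Q)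

  located-leaving : ∀ {Q Q′ : Fin v → Set} {j y u u′ w w′} → (∀ {x} → ¬ Q′ x → Q x) →
                    AtMostOneIn Q j → TwoIn Q′ j → y ∈ j → ¬ Q′ y → u ≡ bl j → w ≡ pt y →
                    Agree Q u u′ → Agree Q′ w w′ → Move G u′ w′ → w′ ≡ w
  located-leaving {j = j} cover one (q , _ , _ , _ , _ , q∈Q′ , _) y∈j y∉Q′ refl refl agree agree′ move
    with unprobed-point q∈Q′ y∉Q′ refl agree′
  ... | y′ , refl , y′∉Q′ with dist-pt≡1 (trans (agree (cover y∉Q′)) (dist-pt-bl-∈ y∈j))
  ...   | i , refl , _ =
    cong pt (one y′∈j y∈j (cover y′∉Q′) (cover y∉Q′))
    where
    y′∈j : y′ ∈ j
    y′∈j = dist-pt-bl≡1 (trans (sym (agree (cover y′∉Q′))) (dist-pt-bl-∈ (move-bl-pt⁻ move)))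

  module Capture {P₁ P₂ : Fin v → Set} (P₁? : Decidable P₁) (P₂? : Decidable P₂)
                 (cover : ∀ x → P₁ x ⊎ P₂ x) where

    schedule : ℕ → Fin v → Set
    schedule 1 = P₂
    schedule _ = P₁

    Consistent : (r r′ : ℕ → Fin (v + b S)) → ℕ → Set
    Consistent r r′ t = ∀ s → s ≤ t → Agree (schedule s) (r s) (r′ s)

    Localized : (ℕ → Fin (v + b S)) → ℕ → Set
    Localized r t = ∀ r′ → IsRobberWalk G r′ → Consistent r r′ t → r′ t ≡ r t

    ¬P₁⇒P₂ : ∀ {x} → ¬ P₁ x → P₂ x
    ¬P₁⇒P₂ {x} x∉P₁ = [ (λ x∈P₁ → contradiction x∈P₁ x∉P₁) , id ]′ (cover x)

    ¬P₂⇒P₁ : ∀ {x} → ¬ P₂ x → P₁ x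
    ¬P₂⇒P₁ {x} x∉P₂ = [ id , (λ x∈P₂ → contradiction x∈P₂ x∉P₂) ]′ (cover x)

    localized-point : ∀ {r t x} → schedule t x → r t ≡ pt x → Localized r t
    localized-point x∈Q e _ _ consistent = located-point x∈Q e (consistent _ ≤-refl)

    localized-block : ∀ {r t j} → TwoIn (schedule t) j → r t ≡ bl j → Localized r t
    localized-block two e _ _ consistent = located-block two e (consistent _ ≤-refl)

    localized-leaving : ∀ {r t j y} → (∀ {x} → ¬ schedule (suc t) x → schedule t x) →
                        AtMostOneIn (schedule t) j → TwoIn (schedule (suc t)) j →
                        y ∈ j → ¬ schedule (suc t) y → r t ≡ bl j → r (suc t) ≡ pt y →
                        Localized r (suc t)
    localized-leaving {t = t} cover′ one two y∈j y∉Q e e′ _ walk′ consistent =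
      located-leaving cover′ one two y∈j y∉Q e e′ (consistent t (n≤1+n t)) (consistent (suc t) ≤-refl) (walk′ t)

    localized-from-point : ∀ {r x} → IsRobberWalk G r → r 0 ≡ pt x → ∃ (Localized r)
    localized-from-point {x = x} walk e₀ with P₁? x
    ... | yes x∈P₁ = 0 , localized-point x∈P₁ e₀
    ... | no x∉P₁ with walk-from-point walk e₀
    ...   | inj₁ e₁ = 1 , localized-point (¬P₁⇒P₂ x∉P₁) e₁
    ...   | inj₂ (j , e₁ , _) with twoIn⊎atMostOneIn P₂? ¬P₂⇒P₁ j
    ...     | inj₁ two₂ = 1 , localized-block two₂ e₁
    ...     | inj₂ (one₂ , two₁) with walk-from-block walk e₁
    ...       | inj₁ e₂ = 2 , localized-block two₁ e₂
    ...       | inj₂ (y , e₂ , y∈j) with P₁? y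
    ...         | yes y∈P₁ = 2 , localized-point y∈P₁ e₂
    ...         | no y∉P₁ = 2 , localized-leaving ¬P₁⇒P₂ one₂ two₁ y∈j y∉P₁ e₁ e₂

    localized-from-block : ∀ {r j} → IsRobberWalk G r → r 0 ≡ bl j → ∃ (Localized r)
    localized-from-block {j = j} walk e₀ with twoIn⊎atMostOneIn P₁? ¬P₁⇒P₂ j
    ... | inj₁ two₁ = 0 , localized-block two₁ e₀
    ... | inj₂ (one₁ , two₂) with walk-from-block walk e₀
    ...   | inj₁ e₁ = 1 , localized-block two₂ e₁
    ...   | inj₂ (w , e₁ , w∈j) with P₂? w
    ...     | yes w∈P₂ = 1 , localized-point w∈P₂ e₁
    ...     | no w∉P₂ = 1 , localized-leaving ¬P₂⇒P₁ one₁ two₂ w∈j w∉P₂ e₀ e₁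

    localized : ∀ r → IsRobberWalk G r → ∃ (Localized r)
    localized r walk = start (vertex (r 0)) refl
      where
      start : ∀ {w} → Vertex w → r 0 ≡ w → ∃ (Localized r)
      start (at-point _) e₀ = localized-from-point walk e₀
      start (at-block _) e₀ = localized-from-block walk e₀

module Halves (v : ℕ) where

  k : ℕ
  k = (v + 1) / 2

  k≤v : k ≤ v
  k≤v = m<1+n⇒m≤n (subst (λ m → m / 2 < suc v) (+-comm 1 v) (m/n<m (suc v) 2 (s≤s (s≤s z≤n))))

  v≤k+k : v ≤ k + k
  v≤k+k = ≤-pred (begin
    suc v                ≡⟨ +-comm 1 v ⟩
    v + 1                ≡⟨ m≡m%n+[m/n]*n (v + 1) 2 ⟩
    (v + 1) % 2 + k * 2  ≤⟨ +-monoˡ-≤ (k * 2) (m<1+n⇒m≤n (m%n<n (v + 1) 2)) ⟩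
    suc (k * 2)          ≡⟨ cong suc (trans (*-comm k 2) (cong (k +_) (+-identityʳ k))) ⟩
    suc (k + k)          ∎)
    where open ≤-Reasoning

  Probed : (Fin v → Fin v) → Fin v → Set
  Probed f x = toℕ (f x) < k

  probed-cover : ∀ x → Probed id x ⊎ Probed opposite x
  probed-cover x with toℕ x <? k
  ... | yes x<k = inj₁ x<k
  ... | no x≮k = inj₂ (begin-strict
    toℕ (opposite x) ≡⟨ opposite-prop x ⟩
    v ∸ suc (toℕ x)  <⟨ ∸-monoʳ-< (n<1+n (toℕ x)) (toℕ<n x) ⟩
    v ∸ toℕ x        ≤⟨ m≤n+o⇒m∸n≤o v (toℕ x) (≤-trans v≤k+k (+-monoˡ-≤ k (≮⇒≥ x≮k))) ⟩
    k                ∎)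
    where open ≤-Reasoning

module Strategy {v : ℕ} (S : STS v) (3<v : 3 < v) where
  open Incidence S 3<v
  open Halves v

  probes : (Fin v → Fin v) → Vec (Fin (v + b S)) k
  probes f = tabulate (λ i → pt (f (inject≤ i k≤v)))

  probes-agree : ∀ f → (∀ x → f (f x) ≡ x) → ∀ {w w′} →
                 map (λ c → dist G c w′) (probes f) ≡ map (λ c → dist G c w) (probes f) →
                 Agree (Probed f) w w′
  probes-agree f involutive {w} {w′} eq {x} x∈ = begin
    dist G (pt x) w′                               ≡⟨ cong (λ c → dist G c w′) probe-x ⟨
    dist G (lookup (probes f) i) w′                ≡⟨ lookup-map i _ (probes f) ⟨
    lookup (map (λ c → dist G c w′) (probes f)) i  ≡⟨ cong (λ ds → lookup ds i) eq ⟩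
    lookup (map (λ c → dist G c w) (probes f)) i   ≡⟨ lookup-map i _ (probes f) ⟩
    dist G (lookup (probes f) i) w                 ≡⟨ cong (λ c → dist G c w) probe-x ⟩
    dist G (pt x) w                                ∎
    where
    open ≡-Reasoning
    i : Fin k
    i = fromℕ< x∈
    probe-x : lookup (probes f) i ≡ pt x
    probe-x = trans (lookup∘tabulate _ i)
      (cong pt (trans (cong f (toℕ-injective (trans (toℕ-inject≤ i k≤v) (toℕ-fromℕ< x∈)))) (involutive x)))

  σ : CopStrategy G k
  σ []          = probes id
  σ (_ ∷ [])    = probes opposite
  σ (_ ∷ _ ∷ _) = probes id

  open Capture {Probed id} {Probed opposite} (λ x → toℕ x <? k) (λ x → toℕ (opposite x) <? k) probed-cover

  consistent : ∀ {r r′ t} → history G σ r′ (suc t) ≡ history G σ r (suc t) → Consistent r r′ t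
  consistent {t = t} eq zero          s≤t = probes-agree id (λ _ → refl) (observations-agree σ t eq 0 s≤t)
  consistent {t = t} eq (suc zero)    s≤t = probes-agree opposite opposite-involutive (observations-agree σ t eq 1 s≤t)
  consistent {t = t} eq (suc (suc s)) s≤t = probes-agree id (λ _ → refl) (observations-agree σ t eq (suc (suc s)) s≤t)

  wins : Wins G σ
  wins r walk with localized r walk
  ... | t , loc = t , λ r′ walk′ eq → loc r′ walk′ (consistent eq)

theorem4p2 : (v : ℕ) → 7 ≤ v → (S : STS v) →
    LocNumAtMost (incidenceGraph S) ((v + 1) / 2)
theorem4p2 v 7≤v S = (v + 1) / 2 , ≤-refl , σ , wins
  where open Strategy S (≤-trans (s≤s (s≤s (s≤s (s≤s z≤n)))) 7≤v)
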